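{- For $n\ge1$ let $\mathcal{F}_n^2$ be the set of forests of $n$ binary shrubs with label set $\{1,\ldots,3n\}$, and for $F=(F_1,\ldots,F_n)\in\mathcal{F}_n^2$ let $\mathrm{risT}(F)=|\{i\in\{1,\dots,n-1\}:F_i<_T F_{i+1}\}|$. Then $$1+\sum_{n\ge1}\frac{t^{3n}}{(3n)!}\sum_{F\in\mathcal{F}_n^2}x^{\mathrm{risT}(F)}=\frac{1-x}{1-x+\sum_{n\ge1}\frac{(2(x-1)t^3)^n}{(3n)!}}.$$
   Context: A binary shrub is a root with an ordered pair of children (left, right), labeled by distinct positive integers with the root's label smaller than both children's labels. A forest of $n$ binary shrubs with label set $\{1,\ldots,3n\}$ is an ordered sequence of $n$ binary shrubs whose labels together are exactly $\{1,\ldots,3n\}$, each used once. For shrubs $F,G$, $F<_T G$ means every label of $F$ is less than every label of $G$. -}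

module Defs where

open import Data.Nat as ℕ using (ℕ; zero; suc; _<_; _≤_; _*_; _∸_; _!)
open import Data.Nat.Properties using (_!≢0; _<?_; _≤?_; _≟_)
open import Data.Nat.Combinatorics using (_C_)
open import Data.Product using (_×_; _,_)
open import Data.Product.Properties using ()
open import Relation.Nullary.Decidable using (Dec; _×-dec_; does)
open import Data.List as List using (List; []; _∷_; [_]; _++_; concatMap; upTo; filter)
open import Data.List.Relation.Unary.All as All using (All)
open import Data.Vec as Vec using (Vec; []; _∷_)
open import Data.Bool using (if_then_else_)
open import Data.Integer as ℤ using (ℤ; +_)
open import Data.Rational as ℚ using (ℚ; 0ℚ; 1ℚ)
open import Relation.Binary.PropositionalEquality using (_≡_)
open import Relation.Unary using (Decidable)

-- A (labelled) binary shrub: (root , left child , right child).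
Shrub : Set
Shrub = ℕ × ℕ × ℕ

IsShrub : Shrub → Set
IsShrub (r , l , s) = (r < l) × (r < s)

shrubLabels : Shrub → List ℕ
shrubLabels (r , l , s) = r ∷ l ∷ s ∷ []

forestLabels : ∀ {n} → Vec Shrub n → List ℕ
forestLabels []      = []
forestLabels (T ∷ F) = shrubLabels T ++ forestLabels F

occ : ℕ → List ℕ → ℕ
occ k []       = 0
occ k (a ∷ as) = if does (k ≟ a) then suc (occ k as) else occ k as

labelSet : ℕ → List ℕ
labelSet n = List.map suc (upTo (3 * n))

IsForest : (n : ℕ) → Vec Shrub n → Set
IsForest n F =
  All IsShrub (Vec.toList F) ×
  All (λ a → (1 ≤ a) × (a ≤ 3 * n)) (forestLabels F) ×
  All (λ k → occ k (forestLabels F) ≡ 1) (labelSet n)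

isForest? : (n : ℕ) → Decidable (IsForest n)
isForest? n F =
  All.all? (λ { (r , l , s) → (r <? l) ×-dec (r <? s) }) (Vec.toList F)
  ×-dec All.all? (λ a → (1 ≤? a) ×-dec (a ≤? 3 * n)) (forestLabels F)
  ×-dec All.all? (λ k → occ k (forestLabels F) ≟ 1) (labelSet n)

allVecs : ∀ {A : Set} → List A → (m : ℕ) → List (Vec A m)
allVecs xs zero    = [ [] ]
allVecs xs (suc m) = concatMap (λ x → List.map (x ∷_) (allVecs xs m)) xs

allTriples : List ℕ → List Shrub
allTriples xs = concatMap (λ a → concatMap (λ b → List.map (λ c → (a , b , c)) xs) xs) xs

-- The set 𝓕ₙ² : all forests of n binary shrubs with label set {1,…,3n}
-- (listed without repetition: a filter of the list of all n-tuples of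
-- triples with entries in {1,…,3n}).
forests : (n : ℕ) → List (Vec Shrub n)
forests n = filter (isForest? n) (allVecs (allTriples (labelSet n)) n)

_<T_ : Shrub → Shrub → Set
T <T U = All (λ a → All (λ b → a < b) (shrubLabels U)) (shrubLabels T)

_<T?_ : (T U : Shrub) → Dec (T <T U)
T <T? U = All.all? (λ a → All.all? (λ b → a <? b) (shrubLabels U)) (shrubLabels T)

risT : ∀ {n} → Vec Shrub n → ℕ
risT []            = 0
risT (T ∷ [])      = 0
risT (T ∷ U ∷ F)   = (if does (T <T? U) then 1 else 0) ℕ.+ risT (U ∷ F)

_^ℚ_ : ℚ → ℕ → ℚ
x ^ℚ zero  = 1ℚ
x ^ℚ suc k = x ℚ.* (x ^ℚ k)

inv! : ℕ → ℚ
inv! m = (+ 1 ℚ./ (m !)) {{m !≢0}}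

sumℚ : List ℚ → ℚ
sumℚ = List.foldr ℚ._+_ 0ℚ

forestPoly : ℚ → ℕ → ℚ
forestPoly x n = sumℚ (List.map (λ F → x ^ℚ risT F) (forests n))

-- coefficient of t^{3n} in  L(t) = 1 + Σ_{n≥1} t^{3n}/(3n)! Σ_F x^{risT F}
lhsCoeff : ℚ → ℕ → ℚ
lhsCoeff x zero    = 1ℚ
lhsCoeff x (suc n) = forestPoly x (suc n) ℚ.* inv! (3 * suc n)

-- coefficient of t^{3n} in  D(t) = 1 - x + Σ_{n≥1} (2(x-1)t³)^n/(3n)!
denCoeff : ℚ → ℕ → ℚ
denCoeff x zero    = 1ℚ ℚ.- x
denCoeff x (suc n) = (((+ 2 ℚ./ 1) ℚ.* (x ℚ.- 1ℚ)) ^ℚ suc n) ℚ.* inv! (3 * suc n)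

-- coefficient of t^{3N} in the product L(t)·D(t)  (Cauchy product)
prodCoeff : ℚ → ℕ → ℚ
prodCoeff x N = sumℚ (List.map (λ k → lhsCoeff x k ℚ.* denCoeff x (N ∸ k)) (upTo (suc N)))

-- Write y = x − 1 and a_n = Σ_{F ∈ 𝓕ₙ²} x^{risT F}. Splitting off the first shrub T = (a, b, c) of a
-- forest T ∷ F gives x^{risT (T ∷ F)} = x^{risT F} + y · [max(b, c) < root of F] · x^{risT F}. Summed over
-- the forests whose labels form a fixed sorted set S of 3k numbers, and weighted by [first root > β],
-- the result depends on S and β only through the number j of labels above β; this gives a recursion
-- for these polynomials ψ_k(j), solved by ψ_k(j) = Σ_{m<k} 2^{m+1} y^m a_{k−1−m} C(j, 3m+3).
-- At j = 3k this reads a_k = Σ_{m<k} C(3k, 3m+3) 2^{m+1} y^m a_{k−1−m}, which after division by (3k)!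
-- says that the coefficient of t^{3k} in the product of the series with the denominator vanishes.

module Submission where

open import Defs
open import Data.Nat using (ℕ; suc)
open import Data.Rational using (ℚ; 0ℚ; 1ℚ; _-_)
open import Relation.Binary.PropositionalEquality using (_≡_)
open import Data.Product using (_×_)

open import Data.Bool using (Bool; true; false; T; if_then_else_; _∧_; _∨_)
open import Data.Bool.Properties using (∨-zeroʳ; ∧-zeroʳ)
open import Data.Empty using (⊥-elim)
import Data.Integer as ℤ
import Data.Integer.Properties as ℤₚ
open import Data.List as List using (List; []; _∷_; _++_; concatMap; length; applyUpTo; upTo)
open import Data.List.Properties using (length-map; length-applyUpTo)
open import Data.List.Relation.Unary.All as All using (All; []; _∷_)
open import Data.List.Relation.Unary.AllPairs using (AllPairs; []; _∷_)
import Data.List.Relation.Unary.All.Properties as Allₚ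
import Data.List.Relation.Unary.AllPairs.Properties as AllPairsₚ
open import Data.List.Relation.Unary.Any using (here; there)
open import Data.List.Membership.Propositional using (_∈_)
open import Data.List.Membership.Propositional.Properties using (∈-map⁺; ∈-upTo⁺)
open import Data.Nat as ℕ using (zero; _∸_; _⊔_; _<ᵇ_; _≡ᵇ_; z≤n; s≤s; _!)
import Data.Nat.Properties as ℕₚ
open import Data.Nat.Properties using (_<?_; _≟_)
open import Data.Product using (_,_; proj₁; proj₂; ∃)
open import Data.Rational as ℚ using (_+_; _*_)
import Data.Rational.Properties as ℚₚ
open import Data.Rational.Solver
open import Data.Rational.Unnormalised as ℚᵘ using (mkℚᵘ; *≡*)
import Data.Rational.Unnormalised.Properties as ℚᵘₚ
open import Data.Unit using (⊤; tt)
open import Data.Vec as Vec using (Vec; []; _∷_)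
open import Function using (case_of_)
open import Relation.Binary.PropositionalEquality using (refl; sym; trans; cong; cong₂; subst; module ≡-Reasoning)
open import Relation.Nullary using (¬_; yes; no)
open import Relation.Nullary.Decidable using (dec-true; dec-false; does)
open import Relation.Unary using (Decidable)

open +-*-Solver using (solve; _:+_; _:*_; _:-_; _:=_; con)

<ᵇ-true : ∀ {m n} → m ℕ.< n → (m <ᵇ n) ≡ true
<ᵇ-true {m} {n} = dec-true (m <? n)

<ᵇ-false : ∀ {m n} → ¬ m ℕ.< n → (m <ᵇ n) ≡ false
<ᵇ-false {m} {n} = dec-false (m <? n)

<ᵇ⇒< : ∀ {m n} → (m <ᵇ n) ≡ true → m ℕ.< n
<ᵇ⇒< {m} {n} e = ℕₚ.<ᵇ⇒< m n (subst T (sym e) tt)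

≡ᵇ-refl : ∀ m → (m ≡ᵇ m) ≡ true
≡ᵇ-refl m = dec-true (m ≟ m) refl

≡ᵇ-false : ∀ {m n} → ¬ m ≡ n → (m ≡ᵇ n) ≡ false
≡ᵇ-false {m} {n} = dec-false (m ≟ n)

<⇒≢ᵇ : ∀ {m n} → m ℕ.< n → (n ≡ᵇ m) ≡ false
<⇒≢ᵇ m<n = ≡ᵇ-false (λ n≡m → ℕₚ.<⇒≢ m<n (sym n≡m))

<⇒≯ᵇ : ∀ {m n} → m ℕ.< n → (n <ᵇ m) ≡ false
<⇒≯ᵇ m<n = <ᵇ-false (ℕₚ.<⇒≯ m<n)

∧-true : ∀ {p q} → p ≡ true → q ≡ true → (p ∧ q) ≡ true
∧-true refl refl = refl

∧-trueˡ : ∀ p {q} → (p ∧ q) ≡ true → p ≡ true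
∧-trueˡ true _ = refl

∧-trueʳ : ∀ p {q} → (p ∧ q) ≡ true → q ≡ true
∧-trueʳ true e = e

ind : Bool → ℚ → ℚ
ind true  q = q
ind false _ = 0ℚ

ind-0 : ∀ p → ind p 0ℚ ≡ 0ℚ
ind-0 true  = refl
ind-0 false = refl

ind-∧ : ∀ p q r → ind (p ∧ q) r ≡ ind p (ind q r)
ind-∧ true  _ _ = refl
ind-∧ false _ _ = refl

ind-cong : ∀ p {q r} → (p ≡ true → q ≡ r) → ind p q ≡ ind p r
ind-cong true  e = e refl
ind-cong false _ = refl

ind-+ : ∀ p u v → ind p (u + v) ≡ ind p u + ind p v
ind-+ true  u v = refl
ind-+ false u v = refl

ind-*ˡ : ∀ p c u → ind p (c * u) ≡ c * ind p u
ind-*ˡ true  c u = refl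
ind-*ˡ false c u = sym (ℚₚ.*-zeroʳ c)

ind-comm : ∀ p q u → ind p (ind q u) ≡ ind q (ind p u)
ind-comm true  q u = refl
ind-comm false q u = sym (ind-0 q)

ΣL : {A : Set} → List A → (A → ℚ) → ℚ
ΣL xs f = sumℚ (List.map f xs)

Σ< : ℕ → (ℕ → ℚ) → ℚ
Σ< zero    f = 0ℚ
Σ< (suc n) f = Σ< n f + f n

module _ {A : Set} where

  ΣL-cong : ∀ (xs : List A) {f g : A → ℚ} → (∀ x → f x ≡ g x) → ΣL xs f ≡ ΣL xs g
  ΣL-cong []       e = refl
  ΣL-cong (x ∷ xs) e = cong₂ _+_ (e x) (ΣL-cong xs e)

  ΣL-congᴬ : ∀ {xs : List A} {f g : A → ℚ} → All (λ x → f x ≡ g x) xs → ΣL xs f ≡ ΣL xs g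
  ΣL-congᴬ []       = refl
  ΣL-congᴬ (e ∷ es) = cong₂ _+_ e (ΣL-congᴬ es)

  ΣL-++ : ∀ (xs ys : List A) (f : A → ℚ) → ΣL (xs ++ ys) f ≡ ΣL xs f + ΣL ys f
  ΣL-++ []       ys f = sym (ℚₚ.+-identityˡ _)
  ΣL-++ (x ∷ xs) ys f = trans (cong (f x +_) (ΣL-++ xs ys f)) (sym (ℚₚ.+-assoc (f x) _ _))

  ΣL-0 : ∀ (xs : List A) → ΣL xs (λ _ → 0ℚ) ≡ 0ℚ
  ΣL-0 []       = refl
  ΣL-0 (x ∷ xs) = cong (0ℚ +_) (ΣL-0 xs)

  ΣL-+ : ∀ (xs : List A) (f g : A → ℚ) → ΣL xs (λ x → f x + g x) ≡ ΣL xs f + ΣL xs g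
  ΣL-+ []       f g = refl
  ΣL-+ (x ∷ xs) f g = trans (cong (f x + g x +_) (ΣL-+ xs f g))
    (solve 4 (λ a b c d → (a :+ b) :+ (c :+ d) := (a :+ c) :+ (b :+ d)) refl (f x) (g x) (ΣL xs f) (ΣL xs g))

  ΣL-*ˡ : ∀ (xs : List A) c (f : A → ℚ) → ΣL xs (λ x → c * f x) ≡ c * ΣL xs f
  ΣL-*ˡ []       c f = sym (ℚₚ.*-zeroʳ c)
  ΣL-*ˡ (x ∷ xs) c f = trans (cong (c * f x +_) (ΣL-*ˡ xs c f)) (sym (ℚₚ.*-distribˡ-+ c (f x) _))

  ΣL-ind : ∀ (xs : List A) p (f : A → ℚ) → ΣL xs (λ x → ind p (f x)) ≡ ind p (ΣL xs f)
  ΣL-ind xs true  f = refl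
  ΣL-ind xs false f = ΣL-0 xs

  ΣL-filter : ∀ {P : A → Set} (P? : Decidable P) (xs : List A) (f : A → ℚ) →
    ΣL (List.filter P? xs) f ≡ ΣL xs (λ x → ind (does (P? x)) (f x))
  ΣL-filter P? []       f = refl
  ΣL-filter P? (x ∷ xs) f with does (P? x)
  ... | true  = cong (f x +_) (ΣL-filter P? xs f)
  ... | false = trans (ΣL-filter P? xs f) (sym (ℚₚ.+-identityˡ _))

module _ {A B : Set} where

  ΣL-map : ∀ (g : A → B) (xs : List A) (f : B → ℚ) → ΣL (List.map g xs) f ≡ ΣL xs (λ x → f (g x))
  ΣL-map g []       f = refl
  ΣL-map g (x ∷ xs) f = cong (f (g x) +_) (ΣL-map g xs f)

  ΣL-concatMap : ∀ (g : A → List B) (xs : List A) (f : B → ℚ) →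
    ΣL (concatMap g xs) f ≡ ΣL xs (λ x → ΣL (g x) f)
  ΣL-concatMap g []       f = refl
  ΣL-concatMap g (x ∷ xs) f =
    trans (ΣL-++ (g x) (concatMap g xs) f) (cong (ΣL (g x) f +_) (ΣL-concatMap g xs f))

Σ<-cong : ∀ n {f g : ℕ → ℚ} → (∀ i → f i ≡ g i) → Σ< n f ≡ Σ< n g
Σ<-cong zero    e = refl
Σ<-cong (suc n) e = cong₂ _+_ (Σ<-cong n e) (e n)

Σ<-cong< : ∀ n {f g : ℕ → ℚ} → (∀ i → i ℕ.< n → f i ≡ g i) → Σ< n f ≡ Σ< n g
Σ<-cong< zero    e = refl
Σ<-cong< (suc n) e = cong₂ _+_ (Σ<-cong< n (λ i i<n → e i (ℕₚ.m<n⇒m<1+n i<n))) (e n (ℕₚ.n<1+n n))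

Σ<-0 : ∀ n → Σ< n (λ _ → 0ℚ) ≡ 0ℚ
Σ<-0 zero    = refl
Σ<-0 (suc n) = cong (_+ 0ℚ) (Σ<-0 n)

Σ<-+ : ∀ n (f g : ℕ → ℚ) → Σ< n (λ i → f i + g i) ≡ Σ< n f + Σ< n g
Σ<-+ zero    f g = refl
Σ<-+ (suc n) f g = trans (cong (_+ (f n + g n)) (Σ<-+ n f g))
  (solve 4 (λ a b c d → (a :+ b) :+ (c :+ d) := (a :+ c) :+ (b :+ d)) refl (Σ< n f) (Σ< n g) (f n) (g n))

Σ<-*ˡ : ∀ n c (f : ℕ → ℚ) → Σ< n (λ i → c * f i) ≡ c * Σ< n f
Σ<-*ˡ zero    c f = sym (ℚₚ.*-zeroʳ c)
Σ<-*ˡ (suc n) c f = trans (cong (_+ c * f n) (Σ<-*ˡ n c f)) (sym (ℚₚ.*-distribˡ-+ c (Σ< n f) (f n)))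

Σ<-swap : ∀ n k (g : ℕ → ℕ → ℚ) → Σ< n (λ i → Σ< k (g i)) ≡ Σ< k (λ m → Σ< n (λ i → g i m))
Σ<-swap zero    k g = sym (Σ<-0 k)
Σ<-swap (suc n) k g = trans (cong (_+ Σ< k (g n)) (Σ<-swap n k g))
  (sym (Σ<-+ k (λ m → Σ< n (λ i → g i m)) (g n)))

Σ<-suc : ∀ n (f : ℕ → ℚ) → Σ< (suc n) f ≡ f 0 + Σ< n (λ i → f (suc i))
Σ<-suc zero    f = trans (ℚₚ.+-identityˡ (f 0)) (sym (ℚₚ.+-identityʳ (f 0)))
Σ<-suc (suc n) f = trans (cong (_+ f (suc n)) (Σ<-suc n f))
  (ℚₚ.+-assoc (f 0) (Σ< n (λ i → f (suc i))) (f (suc n)))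

Σ<-reverse : ∀ n (f : ℕ → ℚ) → Σ< (suc n) f ≡ Σ< (suc n) (λ m → f (n ∸ m))
Σ<-reverse zero    f = refl
Σ<-reverse (suc n) f = trans (cong (_+ f (suc n)) (Σ<-reverse n f))
  (trans (ℚₚ.+-comm _ (f (suc n))) (sym (Σ<-suc (suc n) (λ m → f (suc n ∸ m)))))

ΣL-applyUpTo : ∀ (h : ℕ → ℕ) n (f : ℕ → ℚ) → ΣL (applyUpTo h n) f ≡ Σ< n (λ i → f (h i))
ΣL-applyUpTo h zero    f = refl
ΣL-applyUpTo h (suc n) f = trans (cong (f (h 0) +_) (ΣL-applyUpTo (λ i → h (suc i)) n f))
  (sym (Σ<-suc n (λ i → f (h i))))

memb : ℕ → List ℕ → Bool
memb k []      = false
memb k (s ∷ S) = (k ≡ᵇ s) ∨ memb k S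

del : ℕ → List ℕ → List ℕ
del k []      = []
del k (s ∷ S) = if k ≡ᵇ s then S else s ∷ del k S

countAbove : ℕ → List ℕ → ℕ
countAbove β []      = 0
countAbove β (s ∷ S) = if β <ᵇ s then suc (countAbove β S) else countAbove β S

Sorted : List ℕ → Set
Sorted = AllPairs ℕ._<_

del-head : ∀ s S → del s (s ∷ S) ≡ S
del-head s S rewrite ≡ᵇ-refl s = refl

del-tail : ∀ {a s} S → s ℕ.< a → del a (s ∷ S) ≡ s ∷ del a S
del-tail S s<a rewrite <⇒≢ᵇ s<a = refl

del-All : ∀ {P : ℕ → Set} a S → All P S → All P (del a S)
del-All a []      []       = []
del-All a (s ∷ S) (p ∷ ps) with a ≡ᵇ s
... | true  = ps
... | false = p ∷ del-All a S ps

del-sorted : ∀ a S → Sorted S → Sorted (del a S)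
del-sorted a []      []       = []
del-sorted a (s ∷ S) (p ∷ ps) with a ≡ᵇ s
... | true  = ps
... | false = del-All a S p ∷ del-sorted a S ps

length-del : ∀ a S → memb a S ≡ true → suc (length (del a S)) ≡ length S
length-del a (s ∷ S) m with a ≟ s
... | yes refl rewrite del-head a S = refl
... | no a≢s rewrite ≡ᵇ-false a≢s = cong suc (length-del a S m)

countAbove-all : ∀ β S → All (β ℕ.<_) S → countAbove β S ≡ length S
countAbove-all β []      []       = refl
countAbove-all β (s ∷ S) (p ∷ ps) rewrite <ᵇ-true p = cong suc (countAbove-all β S ps)

countAbove-skip : ∀ {β s} S → ¬ β ℕ.< s → countAbove β (s ∷ S) ≡ countAbove β S
countAbove-skip S β≮s rewrite <ᵇ-false β≮s = refl

memb-head : ∀ s S → memb s (s ∷ S) ≡ true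
memb-head s S rewrite ≡ᵇ-refl s = refl

memb-below : ∀ s S → All (s ℕ.<_) S → memb s S ≡ false
memb-below s []      []       = refl
memb-below s (t ∷ S) (p ∷ ps) rewrite ≡ᵇ-false (ℕₚ.<⇒≢ p) = memb-below s S ps

memb⇒∈ : ∀ {r} S → memb r S ≡ true → r ∈ S
memb⇒∈ {r} (s ∷ S) m with r ≟ s
... | yes refl = here refl
... | no r≢s rewrite ≡ᵇ-false r≢s = there (memb⇒∈ S m)

∈⇒memb : ∀ {r S} → r ∈ S → memb r S ≡ true
∈⇒memb {r} {_ ∷ S} (here refl) = memb-head r S
∈⇒memb {r} (there r∈S) = trans (cong ((r ≡ᵇ _) ∨_) (∈⇒memb r∈S)) (∨-zeroʳ _)

ΣL-pick : ∀ (h : ℕ → ℚ) s U → Sorted U → memb s U ≡ true → ΣL U (λ a → ind (a ≡ᵇ s) (h a)) ≡ h s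
ΣL-pick h s (u ∷ U) (p ∷ ps) m with u ≟ s
... | yes refl rewrite ≡ᵇ-refl u =
  trans (cong (h u +_) (trans (ΣL-congᴬ (All.map (λ {a} u<a → cong (λ z → ind z (h a)) (<⇒≢ᵇ u<a)) p)) (ΣL-0 U)))
        (ℚₚ.+-identityʳ (h u))
... | no u≢s rewrite ≡ᵇ-false u≢s | ≡ᵇ-false (λ s≡u → u≢s (sym s≡u)) =
  trans (ℚₚ.+-identityˡ _) (ΣL-pick h s U ps m)

ΣL-restrict : ∀ (h : ℕ → ℚ) U S → Sorted U → Sorted S → All (λ s → memb s U ≡ true) S →
  ΣL U (λ a → ind (memb a S) (h a)) ≡ ΣL S h
ΣL-restrict h U []      sU sS        []       = ΣL-0 U
ΣL-restrict h U (s ∷ S) sU (p ∷ ps) (m ∷ ms) =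
  trans (ΣL-cong U split-head)
  (trans (ΣL-+ U _ _) (cong₂ _+_ (ΣL-pick h s U sU m) (ΣL-restrict h U S sU ps ms)))
  where
  split-head : ∀ a → ind (memb a (s ∷ S)) (h a) ≡ ind (a ≡ᵇ s) (h a) + ind (memb a S) (h a)
  split-head a with a ≟ s
  ... | yes refl rewrite ≡ᵇ-refl a | memb-below a S p = sym (ℚₚ.+-identityʳ _)
  ... | no a≢s rewrite ≡ᵇ-false a≢s = sym (ℚₚ.+-identityˡ _)

isShrubᵇ : Shrub → Bool
isShrubᵇ (a , b , c) = (a <ᵇ b) ∧ (a <ᵇ c)

del₃ : ℕ → ℕ → ℕ → List ℕ → List ℕ
del₃ a b c S = del c (del b (del a S))

-- Choose the labels of one shrub from a sorted bag S and weight the choice by f of the number of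
-- remaining labels above both children: the resulting sums depend on S only through its length,
-- and, when the root must exceed β, through the number of labels above β.

module RankSums (f : ℕ → ℚ) where

  doubleSum : ℕ → ℚ
  doubleSum L = Σ< L f + Σ< L f

  tripleSum : ℕ → ℚ
  tripleSum j = Σ< j (λ n → Σ< n doubleSum)

  rankSum : List ℕ → ℚ
  rankSum S = ΣL S (λ c → f (countAbove c (del c S)))

  pairSum : List ℕ → ℚ
  pairSum S = ΣL S (λ b → ΣL (del b S) (λ c → f (countAbove (b ⊔ c) (del c (del b S)))))

  shrubWeight : ℕ → ℕ → ℕ → ℕ → List ℕ → ℚ
  shrubWeight β a b c R = ind (isShrubᵇ (a , b , c)) (ind (β <ᵇ a) (f (countAbove (b ⊔ c) R)))

  shrubSum : ℕ → List ℕ → ℚ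
  shrubSum β S =
    ΣL S (λ a → ΣL (del a S) (λ b → ΣL (del b (del a S)) (λ c → shrubWeight β a b c (del₃ a b c S))))

  rankSum-sorted : ∀ S → Sorted S → rankSum S ≡ Σ< (length S) f
  rankSum-sorted []      []       = refl
  rankSum-sorted (s ∷ S) (p ∷ ps) =
    trans (cong₂ _+_ head-term (trans (ΣL-congᴬ (All.map tail-term p)) (rankSum-sorted S ps)))
          (ℚₚ.+-comm (f (length S)) (Σ< (length S) f))
    where
    head-term : f (countAbove s (del s (s ∷ S))) ≡ f (length S)
    head-term = cong f (trans (cong (countAbove s) (del-head s S)) (countAbove-all s S p))
    tail-term : ∀ {c} → s ℕ.< c → f (countAbove c (del c (s ∷ S))) ≡ f (countAbove c (del c S))
    tail-term s<c = cong f (trans (cong (countAbove _) (del-tail S s<c))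
                                  (countAbove-skip (del _ S) (ℕₚ.<⇒≯ s<c)))

  pairSum-sorted : ∀ S → Sorted S → pairSum S ≡ Σ< (length S) doubleSum
  pairSum-sorted []      []       = refl
  pairSum-sorted (s ∷ S) (p ∷ ps) =
    begin
      pairSum (s ∷ S)
    ≡⟨ cong₂ _+_ (trans (cong (λ z → ΣL z (λ c → f (countAbove (s ⊔ c) (del c z)))) (del-head s S))
                        (ΣL-congᴬ (All.map head-pair p)))
                 (ΣL-congᴬ (All.map tail-pair p)) ⟩
      rankSum S + ΣL S (λ b → f (countAbove b (del b S)) +
                              ΣL (del b S) (λ c → f (countAbove (b ⊔ c) (del c (del b S)))))
    ≡⟨ cong (rankSum S +_) (ΣL-+ S _ _) ⟩
      rankSum S + (rankSum S + pairSum S)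
    ≡⟨ cong₂ (λ u v → u + (u + v)) (rankSum-sorted S ps) (pairSum-sorted S ps) ⟩
      Σ< (length S) f + (Σ< (length S) f + Σ< (length S) doubleSum)
    ≡⟨ solve 2 (λ u v → u :+ (u :+ v) := v :+ (u :+ u)) refl (Σ< (length S) f) (Σ< (length S) doubleSum) ⟩
      Σ< (length S) doubleSum + doubleSum (length S)
    ∎
    where
    open ≡-Reasoning
    head-pair : ∀ {c} → s ℕ.< c → f (countAbove (s ⊔ c) (del c S)) ≡ f (countAbove c (del c S))
    head-pair s<c = cong (λ z → f (countAbove z (del _ S))) (ℕₚ.m≤n⇒m⊔n≡n (ℕₚ.<⇒≤ s<c))
    tail-pair : ∀ {b} → s ℕ.< b →
      ΣL (del b (s ∷ S)) (λ c → f (countAbove (b ⊔ c) (del c (del b (s ∷ S)))))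
      ≡ f (countAbove b (del b S)) + ΣL (del b S) (λ c → f (countAbove (b ⊔ c) (del c (del b S))))
    tail-pair {b} s<b rewrite del-tail S s<b =
      cong₂ _+_ (trans (cong (λ z → f (countAbove (b ⊔ s) z)) (del-head s (del b S)))
                       (cong (λ z → f (countAbove z (del b S))) (ℕₚ.m≥n⇒m⊔n≡m (ℕₚ.<⇒≤ s<b))))
                (ΣL-congᴬ (All.map skip-s (del-All b S p)))
      where
      skip-s : ∀ {c} → s ℕ.< c →
        f (countAbove (b ⊔ c) (del c (s ∷ del b S))) ≡ f (countAbove (b ⊔ c) (del c (del b S)))
      skip-s {c} s<c = cong f (trans (cong (countAbove (b ⊔ c)) (del-tail (del b S) s<c))
        (countAbove-skip (del c (del b S)) (ℕₚ.<⇒≯ (ℕₚ.<-≤-trans s<c (ℕₚ.m≤n⊔m b c)))))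

  shrubSum-cons : ∀ β s S → All (s ℕ.<_) S → Sorted S → shrubSum β (s ∷ S) ≡ ind (β <ᵇ s) (pairSum S) + shrubSum β S
  shrubSum-cons β s S p ps = cong₂ _+_ root-s (ΣL-congᴬ (All.map root-above-s p))
    where
    root-s : ΣL (del s (s ∷ S)) (λ b → ΣL (del b (del s (s ∷ S))) (λ c → shrubWeight β s b c (del₃ s b c (s ∷ S))))
             ≡ ind (β <ᵇ s) (pairSum S)
    root-s rewrite del-head s S =
      trans (ΣL-congᴬ (All.map (λ s<b → trans (ΣL-congᴬ (All.map (children-above s<b) (del-All _ S p)))
                                               (ΣL-ind (del _ S) (β <ᵇ s) _)) p))
            (ΣL-ind S (β <ᵇ s) _)
      where
      children-above : ∀ {b c} → s ℕ.< b → s ℕ.< c →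
        shrubWeight β s b c (del c (del b S)) ≡ ind (β <ᵇ s) (f (countAbove (b ⊔ c) (del c (del b S))))
      children-above s<b s<c rewrite <ᵇ-true s<b | <ᵇ-true s<c = refl
    root-above-s : ∀ {a} → s ℕ.< a →
      ΣL (del a (s ∷ S)) (λ b → ΣL (del b (del a (s ∷ S))) (λ c → shrubWeight β a b c (del₃ a b c (s ∷ S))))
      ≡ ΣL (del a S) (λ b → ΣL (del b (del a S)) (λ c → shrubWeight β a b c (del₃ a b c S)))
    root-above-s {a} s<a rewrite del-tail S s<a =
      trans (cong₂ _+_ left-child-s (ΣL-congᴬ (All.map left-child-above-s (del-All a S p)))) (ℚₚ.+-identityˡ _)
      where
      left-child-s : ΣL (del s (s ∷ del a S)) (λ c → shrubWeight β a s c (del c (del s (s ∷ del a S)))) ≡ 0ℚ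
      left-child-s rewrite <⇒≯ᵇ s<a = ΣL-0 (del s (s ∷ del a S))
      left-child-above-s : ∀ {b} → s ℕ.< b →
        ΣL (del b (s ∷ del a S)) (λ c → shrubWeight β a b c (del c (del b (s ∷ del a S))))
        ≡ ΣL (del b (del a S)) (λ c → shrubWeight β a b c (del₃ a b c S))
      left-child-above-s {b} s<b rewrite del-tail (del a S) s<b =
        trans (cong₂ _+_ right-child-s (ΣL-congᴬ (All.map right-child-above-s (del-All b _ (del-All a S p)))))
              (ℚₚ.+-identityˡ _)
        where
        right-child-s : shrubWeight β a b s (del s (s ∷ del b (del a S))) ≡ 0ℚ
        right-child-s rewrite <⇒≯ᵇ s<a | ∧-zeroʳ (a <ᵇ b) = refl
        right-child-above-s : ∀ {c} → s ℕ.< c →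
          shrubWeight β a b c (del c (s ∷ del b (del a S))) ≡ shrubWeight β a b c (del₃ a b c S)
        right-child-above-s {c} s<c
          rewrite del-tail (del b (del a S)) s<c
                | countAbove-skip (del₃ a b c S) (ℕₚ.<⇒≯ (ℕₚ.<-≤-trans s<c (ℕₚ.m≤n⊔m b c))) = refl

  shrubSum-sorted : ∀ β S → Sorted S → shrubSum β S ≡ tripleSum (countAbove β S)
  shrubSum-sorted β []      []       = refl
  shrubSum-sorted β (s ∷ S) (p ∷ ps) with β <? s
  ... | yes β<s
    rewrite shrubSum-cons β s S p ps | <ᵇ-true β<s | shrubSum-sorted β S ps
          | countAbove-all β S (All.map (ℕₚ.<-trans β<s) p) | pairSum-sorted S ps
    = ℚₚ.+-comm (Σ< (length S) doubleSum) (tripleSum (length S))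
  ... | no β≮s
    rewrite shrubSum-cons β s S p ps | <ᵇ-false β≮s | shrubSum-sorted β S ps
    = ℚₚ.+-identityˡ _

labelsIn : List ℕ → Shrub → Bool
labelsIn S (a , b , c) = memb a S ∧ (memb b (del a S) ∧ memb c (del b (del a S)))

isForestOn : List ℕ → ∀ {n} → Vec Shrub n → Bool
isForestOn S []                  = List.null S
isForestOn S (T@(a , b , c) ∷ F) = labelsIn S T ∧ (isShrubᵇ T ∧ isForestOn (del₃ a b c S) F)

-- U only bounds the enumerated labels; the forests counted are those labelled exactly by the bag S.
sumForests : List ℕ → List ℕ → (k : ℕ) → (Vec Shrub k → ℚ) → ℚ
sumForests U S k w = ΣL (allVecs (allTriples U) k) (λ F → ind (isForestOn S F) (w F))

sumForests-cong : ∀ U S k {w w′ : Vec Shrub k → ℚ} →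
  (∀ F → isForestOn S F ≡ true → w F ≡ w′ F) → sumForests U S k w ≡ sumForests U S k w′
sumForests-cong U S k e = ΣL-cong (allVecs (allTriples U) k) (λ F → ind-cong (isForestOn S F) (e F))

sumForests-suc : ∀ U S k (w : Vec Shrub (suc k) → ℚ) →
  sumForests U S (suc k) w ≡
  ΣL U (λ a → ΣL U (λ b → ΣL U (λ c → ind (labelsIn S (a , b , c)) (ind (isShrubᵇ (a , b , c))
    (sumForests U (del₃ a b c S) k (λ F → w ((a , b , c) ∷ F)))))))
sumForests-suc U S k w =
  trans (ΣL-concatMap (λ T → List.map (T ∷_) Fs) (allTriples U) _)
  (trans (ΣL-concatMap _ U _)
  (ΣL-cong U λ a → trans (ΣL-concatMap _ U _)
  (ΣL-cong U λ b → trans (ΣL-map _ U _)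
  (ΣL-cong U λ c → trans (ΣL-map _ Fs _)
    (first-shrub (a , b , c))))))
  where
  Fs : List (Vec Shrub k)
  Fs = allVecs (allTriples U) k
  first-shrub : ∀ T → ΣL Fs (λ F → ind (isForestOn S (T ∷ F)) (w (T ∷ F)))
    ≡ ind (labelsIn S T) (ind (isShrubᵇ T) (sumForests U (del₃ _ _ _ S) k (λ F → w (T ∷ F))))
  first-shrub T@(a , b , c) =
    trans (ΣL-cong Fs (λ F → trans (ind-∧ (labelsIn S T) _ _) (cong (ind (labelsIn S T)) (ind-∧ (isShrubᵇ T) _ _))))
    (trans (ΣL-ind Fs (labelsIn S T) _) (cong (ind (labelsIn S T)) (ΣL-ind Fs (isShrubᵇ T) _)))

ΣL-restrict₃ : ∀ (K : ℕ → ℕ → ℕ → ℚ) U S → Sorted U → Sorted S → All (λ s → memb s U ≡ true) S →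
  ΣL U (λ a → ΣL U (λ b → ΣL U (λ c → ind (labelsIn S (a , b , c)) (K a b c))))
  ≡ ΣL S (λ a → ΣL (del a S) (λ b → ΣL (del b (del a S)) (λ c → K a b c)))
ΣL-restrict₃ K U S sU sS S⊆U = trans (ΣL-cong U restrict-bc) (ΣL-restrict _ U S sU sS S⊆U)
  where
  restrict-bc : ∀ a → ΣL U (λ b → ΣL U (λ c → ind (labelsIn S (a , b , c)) (K a b c)))
    ≡ ind (memb a S) (ΣL (del a S) (λ b → ΣL (del b (del a S)) (λ c → K a b c)))
  restrict-bc a = trans (ΣL-cong U restrict-c)
    (trans (ΣL-ind U (memb a S) _)
      (cong (ind (memb a S)) (ΣL-restrict _ U (del a S) sU (del-sorted a S sS) (del-All a S S⊆U))))
    where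
    restrict-c : ∀ b → ΣL U (λ c → ind (labelsIn S (a , b , c)) (K a b c))
      ≡ ind (memb a S) (ind (memb b (del a S)) (ΣL (del b (del a S)) (λ c → K a b c)))
    restrict-c b =
      trans (ΣL-cong U (λ c → trans (ind-∧ (memb a S) _ _) (cong (ind (memb a S)) (ind-∧ (memb b (del a S)) _ _))))
      (trans (ΣL-ind U (memb a S) _) (cong (ind (memb a S))
      (trans (ΣL-ind U (memb b (del a S)) _) (cong (ind (memb b (del a S)))
        (ΣL-restrict _ U (del b (del a S)) sU (del-sorted b _ (del-sorted a S sS)) (del-All b _ (del-All a S S⊆U)))))))

module _ (U S : List ℕ) (k : ℕ) where

  private
    Fs : List (Vec Shrub k)
    Fs = allVecs (allTriples U) k

  sumForests-+ : ∀ (w w′ : Vec Shrub k → ℚ) →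
    sumForests U S k (λ F → w F + w′ F) ≡ sumForests U S k w + sumForests U S k w′
  sumForests-+ w w′ = trans (ΣL-cong Fs (λ F → ind-+ (isForestOn S F) (w F) (w′ F))) (ΣL-+ Fs _ _)

  sumForests-*ˡ : ∀ c (w : Vec Shrub k → ℚ) → sumForests U S k (λ F → c * w F) ≡ c * sumForests U S k w
  sumForests-*ˡ c w = trans (ΣL-cong Fs (λ F → ind-*ˡ (isForestOn S F) c (w F))) (ΣL-*ˡ Fs c _)

  sumForests-ind : ∀ p (w : Vec Shrub k → ℚ) → sumForests U S k (λ F → ind p (w F)) ≡ ind p (sumForests U S k w)
  sumForests-ind p w = trans (ΣL-cong Fs (λ F → ind-comm (isForestOn S F) p (w F))) (ΣL-ind Fs p _)

HeadIsShrub : ∀ {n} → Vec Shrub n → Set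
HeadIsShrub []      = ⊤
HeadIsShrub (T ∷ _) = IsShrub T

isShrubᵇ⇒IsShrub : ∀ T → isShrubᵇ T ≡ true → IsShrub T
isShrubᵇ⇒IsShrub (a , b , c) e = <ᵇ⇒< (∧-trueˡ (a <ᵇ b) e) , <ᵇ⇒< (∧-trueʳ (a <ᵇ b) e)

isForestOn⇒HeadIsShrub : ∀ S {n} (F : Vec Shrub n) → isForestOn S F ≡ true → HeadIsShrub F
isForestOn⇒HeadIsShrub S []      e = tt
isForestOn⇒HeadIsShrub S (T ∷ F) e =
  isShrubᵇ⇒IsShrub T (∧-trueˡ (isShrubᵇ T) (∧-trueʳ (labelsIn S T) e))

isForestOn⇒root∈ : ∀ S {n} r l s (F : Vec Shrub n) → isForestOn S ((r , l , s) ∷ F) ≡ true → memb r S ≡ true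
isForestOn⇒root∈ S r l s F e = ∧-trueˡ (memb r S) (∧-trueˡ (labelsIn S (r , l , s)) e)

does-<T? : ∀ {a b c r l s} → IsShrub (a , b , c) → IsShrub (r , l , s) →
  does ((a , b , c) <T? (r , l , s)) ≡ ((b ⊔ c) <ᵇ r)
does-<T? {a} {b} {c} {r} {l} {s} (a<b , a<c) (r<l , r<s) with (b ⊔ c) <? r
... | yes b⊔c<r = trans (dec-true ((a , b , c) <T? (r , l , s)) below) (sym (<ᵇ-true b⊔c<r))
  where
  below-root : ∀ {z} → z ℕ.< r → All (z ℕ.<_) (r ∷ l ∷ s ∷ [])
  below-root z<r = z<r ∷ ℕₚ.<-trans z<r r<l ∷ ℕₚ.<-trans z<r r<s ∷ []
  below : (a , b , c) <T (r , l , s)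
  below = below-root (ℕₚ.<-trans a<b (ℕₚ.≤-<-trans (ℕₚ.m≤m⊔n b c) b⊔c<r))
        ∷ below-root (ℕₚ.≤-<-trans (ℕₚ.m≤m⊔n b c) b⊔c<r)
        ∷ below-root (ℕₚ.≤-<-trans (ℕₚ.m≤n⊔m b c) b⊔c<r) ∷ []
... | no b⊔c≮r = trans (dec-false ((a , b , c) <T? (r , l , s)) not-below) (sym (<ᵇ-false b⊔c≮r))
  where
  not-below : ¬ (a , b , c) <T (r , l , s)
  not-below (_ ∷ (b<r ∷ _) ∷ (c<r ∷ _) ∷ []) = b⊔c≮r (ℕₚ.⊔-pres-<m b<r c<r)

record LabelBag (U S : List ℕ) (k : ℕ) : Set where
  field
    sorted-U : Sorted U
    sorted-S : Sorted S
    positive : All (0 ℕ.<_) S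
    S⊆U      : All (λ s → memb s U ≡ true) S
    length≡  : length S ≡ 3 ℕ.* k

LabelBag-del₃ : ∀ {U S k} a b c → LabelBag U S (suc k) → labelsIn S (a , b , c) ≡ true →
  LabelBag U (del₃ a b c S) k
LabelBag-del₃ {U} {S} {k} a b c bag inS = record
  { sorted-U = sorted-U
  ; sorted-S = del-sorted c _ (del-sorted b _ (del-sorted a S sorted-S))
  ; positive = del-All c _ (del-All b _ (del-All a S positive))
  ; S⊆U      = del-All c _ (del-All b _ (del-All a S S⊆U))
  ; length≡  = ℕₚ.suc-injective (ℕₚ.suc-injective (ℕₚ.suc-injective (begin
      suc (suc (suc (length (del₃ a b c S)))) ≡⟨ cong (λ n → suc (suc n)) (length-del c (del b (del a S)) c∈) ⟩
      suc (suc (length (del b (del a S))))    ≡⟨ cong suc (length-del b (del a S) b∈) ⟩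
      suc (length (del a S))                  ≡⟨ length-del a S a∈ ⟩
      length S                                ≡⟨ length≡ ⟩
      3 ℕ.* suc k                             ≡⟨ ℕₚ.*-suc 3 k ⟩
      3 ℕ.+ 3 ℕ.* k                           ∎)))
  }
  where
  open LabelBag bag
  open ≡-Reasoning
  a∈ = ∧-trueˡ (memb a S) inS
  b∈ = ∧-trueˡ (memb b (del a S)) (∧-trueʳ (memb a S) inS)
  c∈ = ∧-trueʳ (memb b (del a S)) (∧-trueʳ (memb a S) inS)

-- The forests of Defs are the forests on the bag labelSet n

Bag : List ℕ → List ℕ → Set
Bag l S = ∀ k → occ k l ≡ occ k S

occ-cong : ∀ k a l l′ → occ k l ≡ occ k l′ → occ k (a ∷ l) ≡ occ k (a ∷ l′)
occ-cong k a _ _ e with k ≡ᵇ a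
... | true  = cong suc e
... | false = e

occ-cancel : ∀ k a l l′ → occ k (a ∷ l) ≡ occ k (a ∷ l′) → occ k l ≡ occ k l′
occ-cancel k a _ _ e with k ≡ᵇ a
... | true  = ℕₚ.suc-injective e
... | false = e

occ-head : ∀ a l → occ a (a ∷ l) ≡ suc (occ a l)
occ-head a l rewrite ≡ᵇ-refl a = refl

occ-del : ∀ k a S → memb a S ≡ true → occ k S ≡ occ k (a ∷ del a S)
occ-del k a (s ∷ S) m with a ≟ s
... | yes refl rewrite del-head a S = refl
... | no a≢s rewrite ≡ᵇ-false a≢s with k ≡ᵇ s | k ≡ᵇ a | occ-del k a S m
...   | true  | true  | e = cong suc e
...   | true  | false | e = cong suc e
...   | false | true  | e = e
...   | false | false | e = e

memb-false⇒occ≡0 : ∀ a S → memb a S ≡ false → occ a S ≡ 0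
memb-false⇒occ≡0 a []      m = refl
memb-false⇒occ≡0 a (s ∷ S) m with a ≡ᵇ s
... | false = memb-false⇒occ≡0 a S m

occ≢0⇒memb : ∀ a S → ¬ occ a S ≡ 0 → memb a S ≡ true
occ≢0⇒memb a S occ≢0 with memb a S in eq
... | true  = refl
... | false = ⊥-elim (occ≢0 (memb-false⇒occ≡0 a S eq))

∈⇒occ≢0 : ∀ {a l} → a ∈ l → ¬ occ a l ≡ 0
∈⇒occ≢0 {a} {_ ∷ l} (here refl) rewrite occ-head a l = λ ()
∈⇒occ≢0 {a} {b ∷ l} (there a∈l) with a ≡ᵇ b
... | true  = λ ()
... | false = ∈⇒occ≢0 a∈l

occ-sorted : ∀ S → Sorted S → All (λ k → occ k S ≡ 1) S
occ-sorted []      []       = []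
occ-sorted (s ∷ S) (p ∷ ps) =
  trans (occ-head s S) (cong suc (memb-false⇒occ≡0 s S (memb-below s S p)))
  ∷ All.zipWith (λ (s<t , occ≡1) → trans (occ-skip s<t) occ≡1) (p , occ-sorted S ps)
  where
  occ-skip : ∀ {t} → s ℕ.< t → occ t (s ∷ S) ≡ occ t S
  occ-skip s<t rewrite <⇒≢ᵇ s<t = refl

Bag-del : ∀ a l S → memb a S ≡ true → Bag l (del a S) → Bag (a ∷ l) S
Bag-del a l S a∈ bag k = trans (occ-cong k a l (del a S) (bag k)) (sym (occ-del k a S a∈))

Bag⇒memb : ∀ a l S → Bag (a ∷ l) S → memb a S ≡ true
Bag⇒memb a l S bag = occ≢0⇒memb a S (λ occ≡0 → ℕₚ.1+n≢0 (trans (sym (occ-head a l)) (trans (bag a) occ≡0)))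

Bag⇒Bag-del : ∀ a l S → Bag (a ∷ l) S → Bag l (del a S)
Bag⇒Bag-del a l S bag k = occ-cancel k a l (del a S) (trans (bag k) (occ-del k a S (Bag⇒memb a l S bag)))

ForestOn : List ℕ → ∀ {n} → Vec Shrub n → Set
ForestOn S F = All IsShrub (Vec.toList F) × Bag (forestLabels F) S

isForestOn⇒ForestOn : ∀ S {n} (F : Vec Shrub n) → isForestOn S F ≡ true → ForestOn S F
isForestOn⇒ForestOn []      []      e = [] , λ k → refl
isForestOn⇒ForestOn S (T@(a , b , c) ∷ F) e =
  isShrubᵇ⇒IsShrub T (∧-trueˡ (isShrubᵇ T) rest) ∷ proj₁ forest ,
  Bag-del a (b ∷ c ∷ lF) S a∈ (Bag-del b (c ∷ lF) (del a S) b∈ (Bag-del c lF (del b (del a S)) c∈ (proj₂ forest)))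
  where
  lF = forestLabels F
  inS  = ∧-trueˡ (labelsIn S T) e
  rest = ∧-trueʳ (labelsIn S T) e
  a∈ = ∧-trueˡ (memb a S) inS
  b∈ = ∧-trueˡ (memb b (del a S)) (∧-trueʳ (memb a S) inS)
  c∈ = ∧-trueʳ (memb b (del a S)) (∧-trueʳ (memb a S) inS)
  forest = isForestOn⇒ForestOn (del₃ a b c S) F (∧-trueʳ (isShrubᵇ T) rest)

ForestOn⇒isForestOn : ∀ S {n} (F : Vec Shrub n) → ForestOn S F → isForestOn S F ≡ true
ForestOn⇒isForestOn []      []      _        = refl
ForestOn⇒isForestOn (s ∷ S) []      (_ , bag) = ⊥-elim (ℕₚ.0≢1+n (trans (bag s) (occ-head s S)))
ForestOn⇒isForestOn S ((a , b , c) ∷ F) ((a<b , a<c) ∷ shrubs , bag) =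
  ∧-true (∧-true (Bag⇒memb a (b ∷ c ∷ lF) S bag) (∧-true (Bag⇒memb b (c ∷ lF) S₁ bag₁) (Bag⇒memb c lF S₂ bag₂)))
    (∧-true (∧-true (<ᵇ-true a<b) (<ᵇ-true a<c))
      (ForestOn⇒isForestOn (del₃ a b c S) F (shrubs , Bag⇒Bag-del c lF S₂ bag₂)))
  where
  lF = forestLabels F
  S₁ = del a S
  S₂ = del b S₁
  bag₁ = Bag⇒Bag-del a (b ∷ c ∷ lF) S bag
  bag₂ = Bag⇒Bag-del b (c ∷ lF) S₁ bag₁

module _ (n : ℕ) where

  private
    L = labelSet n

  labelSet-sorted : Sorted L
  labelSet-sorted = AllPairsₚ.map⁺ (AllPairsₚ.applyUpTo⁺₁ (λ i → i) (3 ℕ.* n) (λ i<j _ → s≤s i<j))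

  labelSet-bounds : All (λ a → (1 ℕ.≤ a) × (a ℕ.≤ 3 ℕ.* n)) L
  labelSet-bounds = Allₚ.map⁺ (Allₚ.applyUpTo⁺₁ (λ i → i) (3 ℕ.* n) (λ i<3n → s≤s z≤n , i<3n))

  labelSet-length : length L ≡ 3 ℕ.* n
  labelSet-length = trans (length-map suc (upTo (3 ℕ.* n))) (length-applyUpTo (λ i → i) (3 ℕ.* n))

  bounds⇒∈labelSet : ∀ {k} → (1 ℕ.≤ k) × (k ℕ.≤ 3 ℕ.* n) → k ∈ L
  bounds⇒∈labelSet {suc i} (_ , i<3n) = ∈-map⁺ suc (∈-upTo⁺ i<3n)

  labelSet-LabelBag : LabelBag L L n
  labelSet-LabelBag = record
    { sorted-U = labelSet-sorted
    ; sorted-S = labelSet-sorted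
    ; positive = All.map proj₁ labelSet-bounds
    ; S⊆U      = All.tabulate ∈⇒memb
    ; length≡  = labelSet-length
    }

  ForestOn⇒IsForest : (F : Vec Shrub n) → ForestOn L F → IsForest n F
  ForestOn⇒IsForest F (shrubs , bag) =
    shrubs ,
    All.tabulate (λ {a} a∈F → All.lookup labelSet-bounds
      (memb⇒∈ L (occ≢0⇒memb a L (λ occ≡0 → ∈⇒occ≢0 a∈F (trans (bag a) occ≡0))))) ,
    All.map (λ {k} occ≡1 → trans (bag k) occ≡1) (occ-sorted L labelSet-sorted)

  IsForest⇒ForestOn : (F : Vec Shrub n) → IsForest n F → ForestOn L F
  IsForest⇒ForestOn F (shrubs , bounds , once) = shrubs , bag
    where
    bag : Bag (forestLabels F) L
    bag k with memb k L in k∈?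
    ... | true  = trans (All.lookup once k∈) (sym (All.lookup (occ-sorted L labelSet-sorted) k∈))
      where k∈ = memb⇒∈ L k∈?
    ... | false with memb k (forestLabels F) in k∈F?
    ...   | false = trans (memb-false⇒occ≡0 k (forestLabels F) k∈F?) (sym (memb-false⇒occ≡0 k L k∈?))
    ...   | true  = case trans (sym (∈⇒memb k∈L)) k∈? of λ ()
      where k∈L = bounds⇒∈labelSet (All.lookup bounds (memb⇒∈ (forestLabels F) k∈F?))

  isForest?≡isForestOn : (F : Vec Shrub n) → does (isForest? n F) ≡ isForestOn L F
  isForest?≡isForestOn F with isForestOn L F in e
  ... | true  = dec-true (isForest? n F) (ForestOn⇒IsForest F (isForestOn⇒ForestOn L F e))
  ... | false = dec-false (isForest? n F) (λ isF →
                  case trans (sym (ForestOn⇒isForestOn L F (IsForest⇒ForestOn F isF))) e of λ ())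

  sum-forests : ∀ (w : Vec Shrub n → ℚ) → sumℚ (List.map w (forests n)) ≡ sumForests L L n w
  sum-forests w = trans (ΣL-filter (isForest? n) (allVecs (allTriples L) n) w)
    (ΣL-cong (allVecs (allTriples L) n) (λ F → cong (λ p → ind p (w F)) (isForest?≡isForestOn F)))

⟦_⟧ : ℕ → ℚ
⟦ n ⟧ = ℤ.+ n ℚ./ 1

private
  frac : ℕ → ℕ → ℚ
  frac a b = ℤ.+ a ℚ./ suc b

  pos-cross : ∀ p q r s → p ℕ.* suc r ≡ s ℕ.* q → (ℤ.+ p) ℤ.* ℤ.+ suc r ≡ ℤ.+ s ℤ.* ℤ.+ q
  pos-cross p q r s eq =
    trans (sym (ℤₚ.pos-* p (suc r))) (trans (cong ℤ.+_ eq) (ℤₚ.pos-* s q))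

  toℚᵘ-frac : ∀ a b → ℚ.toℚᵘ (frac a b) ℚᵘ.≃ mkℚᵘ (ℤ.+ a) b
  toℚᵘ-frac a b = ℚₚ.toℚᵘ-fromℚᵘ (mkℚᵘ (ℤ.+ a) b)

  frac-* : ∀ a b c d e f → a ℕ.* c ℕ.* suc f ≡ e ℕ.* (suc b ℕ.* suc d) → frac a b * frac c d ≡ frac e f
  frac-* a b c d e f eq = ℚₚ.toℚᵘ-injective
    (ℚᵘₚ.≃-trans (ℚₚ.toℚᵘ-homo-* (frac a b) (frac c d))
    (ℚᵘₚ.≃-trans (ℚᵘₚ.*-cong (toℚᵘ-frac a b) (toℚᵘ-frac c d))
    (ℚᵘₚ.≃-trans (*≡* cross) (ℚᵘₚ.≃-sym (toℚᵘ-frac e f)))))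
    where
    cross : ℤ.+ a ℤ.* ℤ.+ c ℤ.* ℤ.+ suc f ≡ ℤ.+ e ℤ.* ℤ.+ (suc b ℕ.* suc d)
    cross = subst (λ z → z ℤ.* ℤ.+ suc f ≡ _) (ℤₚ.pos-* a c) (pos-cross (a ℕ.* c) _ f e eq)

  frac-+ : ∀ a b c d e f → (a ℕ.* suc d ℕ.+ c ℕ.* suc b) ℕ.* suc f ≡ e ℕ.* (suc b ℕ.* suc d) →
    frac a b + frac c d ≡ frac e f
  frac-+ a b c d e f eq = ℚₚ.toℚᵘ-injective
    (ℚᵘₚ.≃-trans (ℚₚ.toℚᵘ-homo-+ (frac a b) (frac c d))
    (ℚᵘₚ.≃-trans (ℚᵘₚ.+-cong (toℚᵘ-frac a b) (toℚᵘ-frac c d))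
    (ℚᵘₚ.≃-trans (*≡* cross) (ℚᵘₚ.≃-sym (toℚᵘ-frac e f)))))
    where
    numerator : ℤ.+ (a ℕ.* suc d ℕ.+ c ℕ.* suc b) ≡ ℤ.+ a ℤ.* ℤ.+ suc d ℤ.+ ℤ.+ c ℤ.* ℤ.+ suc b
    numerator = trans (ℤₚ.pos-+ (a ℕ.* suc d) (c ℕ.* suc b)) (cong₂ ℤ._+_ (ℤₚ.pos-* a (suc d)) (ℤₚ.pos-* c (suc b)))
    cross : (ℤ.+ a ℤ.* ℤ.+ suc d ℤ.+ ℤ.+ c ℤ.* ℤ.+ suc b) ℤ.* ℤ.+ suc f ≡ ℤ.+ e ℤ.* ℤ.+ (suc b ℕ.* suc d)
    cross = subst (λ z → z ℤ.* ℤ.+ suc f ≡ _) numerator (pos-cross (a ℕ.* suc d ℕ.+ c ℕ.* suc b) _ f e eq)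

  inv!≡frac : ∀ n {k} → n ! ≡ suc k → inv! n ≡ frac 1 k
  inv!≡frac n eq = ℚₚ./-cong {p₁ = ℤ.+ 1} {{n ℕₚ.!≢0}} refl eq

  factorial≡suc : ∀ n → ∃ λ k → n ! ≡ suc k
  factorial≡suc n with n ! | ℕₚ.1≤n! n
  ... | suc k | _ = k , refl

⟦⟧-+ : ∀ m n → ⟦ m ℕ.+ n ⟧ ≡ ⟦ m ⟧ + ⟦ n ⟧
⟦⟧-+ m n = sym (frac-+ m 0 n 0 (m ℕ.+ n) 0
  (cong (ℕ._* 1) (cong₂ ℕ._+_ (ℕₚ.*-identityʳ m) (ℕₚ.*-identityʳ n))))

⟦⟧-* : ∀ m n → ⟦ m ℕ.* n ⟧ ≡ ⟦ m ⟧ * ⟦ n ⟧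
⟦⟧-* m n = sym (frac-* m 0 n 0 (m ℕ.* n) 0 refl)

⟦n!⟧*inv!n≡1 : ∀ n → ⟦ n ! ⟧ * inv! n ≡ 1ℚ
⟦n!⟧*inv!n≡1 n with factorial≡suc n
... | k , eq rewrite inv!≡frac n eq | eq = frac-* (suc k) 0 1 k 1 0
  (trans (ℕₚ.*-identityʳ (suc k ℕ.* 1)) (trans (ℕₚ.*-identityʳ (suc k))
    (sym (trans (ℕₚ.*-identityˡ _) (ℕₚ.*-identityˡ _)))))

⟦1+n⟧*inv![1+n]≡inv!n : ∀ n → ⟦ suc n ⟧ * inv! (suc n) ≡ inv! n
⟦1+n⟧*inv![1+n]≡inv!n n with factorial≡suc n | factorial≡suc (suc n)
... | k , eq | k′ , eq′ rewrite inv!≡frac n eq | inv!≡frac (suc n) eq′ = frac-* (suc n) 0 1 k′ 1 k (begin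
  suc n ℕ.* 1 ℕ.* suc k    ≡⟨ cong (ℕ._* suc k) (ℕₚ.*-identityʳ (suc n)) ⟩
  suc n ℕ.* suc k          ≡⟨ cong (suc n ℕ.*_) (sym eq) ⟩
  suc n !                  ≡⟨ eq′ ⟩
  suc k′                   ≡⟨ sym (trans (ℕₚ.*-identityˡ _) (ℕₚ.*-identityˡ _)) ⟩
  1 ℕ.* (1 ℕ.* suc k′)     ∎)
  where open ≡-Reasoning

*-cancelʳ-⟦suc⟧ : ∀ m {p q} → p * ⟦ suc m ⟧ ≡ q * ⟦ suc m ⟧ → p ≡ q
*-cancelʳ-⟦suc⟧ m {p} {q} eq = begin
  p                    ≡⟨ sym (ℚₚ.*-identityʳ p) ⟩
  p * 1ℚ               ≡⟨ cong (p *_) (sym inverse) ⟩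
  p * (⟦ suc m ⟧ * u)  ≡⟨ sym (ℚₚ.*-assoc p _ u) ⟩
  p * ⟦ suc m ⟧ * u    ≡⟨ cong (_* u) eq ⟩
  q * ⟦ suc m ⟧ * u    ≡⟨ ℚₚ.*-assoc q _ u ⟩
  q * (⟦ suc m ⟧ * u)  ≡⟨ cong (q *_) inverse ⟩
  q * 1ℚ               ≡⟨ ℚₚ.*-identityʳ q ⟩
  q                    ∎
  where
  open ≡-Reasoning
  u = ⟦ m ! ⟧ * inv! (suc m)
  inverse : ⟦ suc m ⟧ * u ≡ 1ℚ
  inverse = trans (sym (ℚₚ.*-assoc ⟦ suc m ⟧ ⟦ m ! ⟧ (inv! (suc m))))
                  (trans (cong (_* inv! (suc m)) (sym (⟦⟧-* (suc m) (m !)))) (⟦n!⟧*inv!n≡1 (suc m)))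

choose : ℕ → ℕ → ℚ
choose n       zero    = 1ℚ
choose zero    (suc k) = 0ℚ
choose (suc n) (suc k) = choose n k + choose n (suc k)

choose-< : ∀ {n k} → n ℕ.< k → choose n k ≡ 0ℚ
choose-< {zero}  {suc k} _         = refl
choose-< {suc n} {suc k} (s≤s n<k) = cong₂ _+_ (choose-< n<k) (choose-< (ℕₚ.m<n⇒m<1+n n<k))

choose-diag : ∀ n → choose n n ≡ 1ℚ
choose-diag zero    = refl
choose-diag (suc n) = cong₂ _+_ (choose-diag n) (choose-< (ℕₚ.n<1+n n))

choose-hockey : ∀ n p → Σ< n (λ i → choose i p) ≡ choose n (suc p)
choose-hockey zero    p = refl
choose-hockey (suc n) p = trans (cong (_+ choose n p) (choose-hockey n p)) (ℚₚ.+-comm (choose n (suc p)) (choose n p))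

-- The step multiplies by p + q + 1 and uses Pascal's rule on the left, (k + 1) · (k + 1)!⁻¹ = k!⁻¹ on the right.
choose-inv! : ∀ p q → choose (p ℕ.+ q) p * inv! (p ℕ.+ q) ≡ inv! p * inv! q
choose-inv! zero    q = refl
choose-inv! (suc p) zero rewrite ℕₚ.+-identityʳ p | choose-diag (suc p) = ℚₚ.*-comm 1ℚ (inv! (suc p))
choose-inv! (suc p) (suc q) = *-cancelʳ-⟦suc⟧ m (begin
  (C₁ + C₂) * inv! (suc m) * ⟦ suc m ⟧
    ≡⟨ solve 4 (λ a b i n → (a :+ b) :* i :* n := a :* (n :* i) :+ b :* (n :* i)) refl C₁ C₂ (inv! (suc m)) ⟦ suc m ⟧ ⟩
  C₁ * (⟦ suc m ⟧ * inv! (suc m)) + C₂ * (⟦ suc m ⟧ * inv! (suc m))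
    ≡⟨ cong₂ (λ u v → C₁ * u + C₂ * v) (⟦1+n⟧*inv![1+n]≡inv!n m) (⟦1+n⟧*inv![1+n]≡inv!n m) ⟩
  C₁ * inv! m + C₂ * inv! m
    ≡⟨ cong₂ _+_ (choose-inv! p (suc q)) C₂-inv! ⟩
  inv! p * inv! (suc q) + inv! (suc p) * inv! q
    ≡⟨ cong₂ (λ u v → u * inv! (suc q) + inv! (suc p) * v)
         (sym (⟦1+n⟧*inv![1+n]≡inv!n p)) (sym (⟦1+n⟧*inv![1+n]≡inv!n q)) ⟩
  ⟦ suc p ⟧ * inv! (suc p) * inv! (suc q) + inv! (suc p) * (⟦ suc q ⟧ * inv! (suc q))
    ≡⟨ solve 4 (λ a b i j → a :* i :* j :+ i :* (b :* j) := i :* j :* (a :+ b))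
         refl ⟦ suc p ⟧ ⟦ suc q ⟧ (inv! (suc p)) (inv! (suc q)) ⟩
  inv! (suc p) * inv! (suc q) * (⟦ suc p ⟧ + ⟦ suc q ⟧)
    ≡⟨ cong (inv! (suc p) * inv! (suc q) *_) (sym (⟦⟧-+ (suc p) (suc q))) ⟩
  inv! (suc p) * inv! (suc q) * ⟦ suc m ⟧
    ∎)
  where
  open ≡-Reasoning
  m = p ℕ.+ suc q
  C₁ = choose m p
  C₂ = choose m (suc p)
  C₂-inv! : C₂ * inv! m ≡ inv! (suc p) * inv! q
  C₂-inv! = subst (λ n → choose n (suc p) * inv! n ≡ inv! (suc p) * inv! q) (sym (ℕₚ.+-suc p q)) (choose-inv! (suc p) q)

binomSum : ℕ → (ℕ → ℚ) → (ℕ → ℕ) → ℕ → ℚ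
binomSum k c p i = Σ< k (λ m → c m * choose i (p m))

Σ<-binomSum : ∀ n k c p → Σ< n (binomSum k c p) ≡ binomSum k c (λ m → suc (p m)) n
Σ<-binomSum n k c p = trans (Σ<-swap n k (λ i m → c m * choose i (p m)))
  (Σ<-cong k (λ m → trans (Σ<-*ˡ n (c m) (λ i → choose i (p m))) (cong (c m *_) (choose-hockey n (p m)))))

binomSum-double : ∀ k c p i → binomSum k c p i + binomSum k c p i ≡ binomSum k (λ m → c m + c m) p i
binomSum-double k c p i =
  trans (sym (Σ<-+ k _ _)) (Σ<-cong k (λ m → sym (ℚₚ.*-distribʳ-+ (choose i (p m)) (c m) (c m))))

tripleSum-cong : ∀ {f g : ℕ → ℚ} → (∀ i → f i ≡ g i) → ∀ j → RankSums.tripleSum f j ≡ RankSums.tripleSum g j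
tripleSum-cong e j = Σ<-cong j (λ n → Σ<-cong n (λ L → cong₂ _+_ (Σ<-cong L e) (Σ<-cong L e)))

tripleSum-binomSum : ∀ k c p j →
  RankSums.tripleSum (binomSum k c p) j ≡ binomSum k (λ m → c m + c m) (λ m → 3 ℕ.+ p m) j
tripleSum-binomSum k c p j =
  trans (Σ<-cong j (λ n → Σ<-cong n (λ L →
     trans (cong₂ _+_ (Σ<-binomSum L k c p) (Σ<-binomSum L k c p)) (binomSum-double k c (λ m → suc (p m)) L))))
  (trans (Σ<-cong j (λ n → Σ<-binomSum n k (λ m → c m + c m) (λ m → suc (p m))))
         (Σ<-binomSum j k (λ m → c m + c m) (λ m → suc (suc (p m)))))

module Count (x : ℚ) where

  y : ℚ
  y = x - 1ℚ

  weight : ∀ {n} → Vec Shrub n → ℚ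
  weight F = x ^ℚ risT F

  weightAbove : ℕ → ∀ {n} → Vec Shrub n → ℚ
  weightAbove β []                  = 0ℚ
  weightAbove β (T@(r , _ , _) ∷ F) = ind (β <ᵇ r) (weight (T ∷ F))

  weight-cons : ∀ {a b c n} (F : Vec Shrub n) → IsShrub (a , b , c) → HeadIsShrub F →
    weight ((a , b , c) ∷ F) ≡ weight F + y * weightAbove (b ⊔ c) F
  weight-cons []      _      _ = sym (trans (cong (1ℚ +_) (ℚₚ.*-zeroʳ y)) (ℚₚ.+-identityʳ 1ℚ))
  weight-cons {b = b} {c} (U@(r , _ , _) ∷ F) T-shrub U-shrub
    rewrite does-<T? T-shrub U-shrub with (b ⊔ c) <ᵇ r
  ... | true  = solve 2 (λ x w → x :* w := w :+ (x :- con 1ℚ) :* w) refl x (weight (U ∷ F))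
  ... | false = sym (trans (cong (weight (U ∷ F) +_) (ℚₚ.*-zeroʳ y)) (ℚₚ.+-identityʳ _))

  recPoly      : ℕ → ℚ
  recPolyAbove : ℕ → ℕ → ℚ

  recPoly zero    = 1ℚ
  recPoly (suc k) = recPolyAbove (suc k) (3 ℕ.* suc k)

  recPolyAbove zero    j = 0ℚ
  recPolyAbove (suc k) j = RankSums.tripleSum (λ i → recPoly k + y * recPolyAbove k i) j

  sumForests-weight      : ∀ k {U S} → LabelBag U S k → sumForests U S k weight ≡ recPoly k
  sumForests-weightAbove : ∀ k {U S} → LabelBag U S k → ∀ β →
    sumForests U S k (weightAbove β) ≡ recPolyAbove k (countAbove β S)

  sumForests-weight zero {S = []} _ = ℚₚ.+-identityʳ 1ℚ
  sumForests-weight (suc k) {U} {S} bag = begin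
    sumForests U S (suc k) weight              ≡⟨ sumForests-cong U S (suc k) weight≡weightAbove0 ⟩
    sumForests U S (suc k) (weightAbove 0)     ≡⟨ sumForests-weightAbove (suc k) bag 0 ⟩
    recPolyAbove (suc k) (countAbove 0 S)      ≡⟨ cong (recPolyAbove (suc k)) (trans (countAbove-all 0 S positive) length≡) ⟩
    recPolyAbove (suc k) (3 ℕ.* suc k)         ∎
    where
    open ≡-Reasoning
    open LabelBag bag
    weight≡weightAbove0 : ∀ F → isForestOn S F ≡ true → weight F ≡ weightAbove 0 F
    weight≡weightAbove0 ((r , l , s) ∷ F) e
      rewrite <ᵇ-true (All.lookup positive (memb⇒∈ S (isForestOn⇒root∈ S r l s F e))) = refl

  sumForests-weightAbove zero {S = S} _ β = trans (cong (_+ 0ℚ) (ind-0 (List.null S))) (ℚₚ.+-identityʳ 0ℚ)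
  sumForests-weightAbove (suc k) {U} {S} bag β = begin
    sumForests U S (suc k) (weightAbove β)
      ≡⟨ sumForests-suc U S k (weightAbove β) ⟩
    ΣL U (λ a → ΣL U (λ b → ΣL U (λ c → ind (labelsIn S (a , b , c)) (ind (isShrubᵇ (a , b , c))
      (sumForests U (del₃ a b c S) k (λ F → weightAbove β ((a , b , c) ∷ F)))))))
      ≡⟨ ΣL-cong U (λ a → ΣL-cong U (λ b → ΣL-cong U (λ c →
           ind-cong (labelsIn S (a , b , c)) (λ inS → ind-cong (isShrubᵇ (a , b , c)) (first-shrub inS))))) ⟩
    ΣL U (λ a → ΣL U (λ b → ΣL U (λ c → ind (labelsIn S (a , b , c)) (shrubWeight β a b c (del₃ a b c S)))))
      ≡⟨ ΣL-restrict₃ (λ a b c → shrubWeight β a b c (del₃ a b c S)) U S sorted-U sorted-S S⊆U ⟩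
    shrubSum β S
      ≡⟨ shrubSum-sorted β S sorted-S ⟩
    tripleSum (countAbove β S)
      ∎
    where
    open ≡-Reasoning
    open LabelBag bag
    open RankSums (λ i → recPoly k + y * recPolyAbove k i)
    first-shrub : ∀ {a b c} → labelsIn S (a , b , c) ≡ true → isShrubᵇ (a , b , c) ≡ true →
      sumForests U (del₃ a b c S) k (λ F → weightAbove β ((a , b , c) ∷ F))
      ≡ ind (β <ᵇ a) (recPoly k + y * recPolyAbove k (countAbove (b ⊔ c) (del₃ a b c S)))
    first-shrub {a} {b} {c} inS shrub = begin
      sumForests U S′ k (λ F → ind (β <ᵇ a) (weight ((a , b , c) ∷ F)))
        ≡⟨ sumForests-cong U S′ k (λ F e → cong (ind (β <ᵇ a))
             (weight-cons F (isShrubᵇ⇒IsShrub (a , b , c) shrub) (isForestOn⇒HeadIsShrub S′ F e))) ⟩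
      sumForests U S′ k (λ F → ind (β <ᵇ a) (weight F + y * weightAbove (b ⊔ c) F))
        ≡⟨ sumForests-ind U S′ k (β <ᵇ a) _ ⟩
      ind (β <ᵇ a) (sumForests U S′ k (λ F → weight F + y * weightAbove (b ⊔ c) F))
        ≡⟨ cong (ind (β <ᵇ a)) (trans (sumForests-+ U S′ k _ _) (cong (sumForests U S′ k weight +_)
             (sumForests-*ˡ U S′ k y (weightAbove (b ⊔ c))))) ⟩
      ind (β <ᵇ a) (sumForests U S′ k weight + y * sumForests U S′ k (weightAbove (b ⊔ c)))
        ≡⟨ cong (ind (β <ᵇ a)) (cong₂ (λ u v → u + y * v) (sumForests-weight k bag′)
             (sumForests-weightAbove k bag′ (b ⊔ c))) ⟩
      ind (β <ᵇ a) (recPoly k + y * recPolyAbove k (countAbove (b ⊔ c) S′))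
        ∎
      where
      S′ = del₃ a b c S
      bag′ = LabelBag-del₃ a b c bag inS

  two : ℚ
  two = ℤ.+ 2 ℚ./ 1

  -- 2^{m+1} y^m: there are 2^{m+1} chains of m + 1 shrubs, each below the next, on 3m + 3 labels,
  -- and each of the m rises of such a chain carries a factor y.
  blockWeight : ℕ → ℚ
  blockWeight m = (two * y) ^ℚ m * two

  y*blockWeight : ∀ m → y * blockWeight m ≡ (two * y) ^ℚ suc m
  y*blockWeight m = solve 2 (λ y p → y :* (p :* con two) := con two :* y :* p) refl y ((two * y) ^ℚ m)

  recPolyAbove-closed : ∀ k j →
    recPolyAbove k j ≡ binomSum k (λ m → blockWeight m * recPoly (k ∸ suc m)) (λ m → 3 ℕ.* suc m) j
  recPolyAbove-closed zero    j = refl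
  recPolyAbove-closed (suc k) j =
    trans (tripleSum-cong with-constant j) (trans (tripleSum-binomSum (suc k) c′ p′ j) (Σ<-cong (suc k) term))
    where
    c : ℕ → ℚ
    c m = blockWeight m * recPoly (k ∸ suc m)
    c′ : ℕ → ℚ
    c′ zero    = recPoly k
    c′ (suc m) = y * c m
    p′ : ℕ → ℕ
    p′ zero    = 0
    p′ (suc m) = 3 ℕ.* suc m
    with-constant : ∀ i → recPoly k + y * recPolyAbove k i ≡ binomSum (suc k) c′ p′ i
    with-constant i = sym (trans (Σ<-suc k (λ m → c′ m * choose i (p′ m)))
      (cong₂ _+_ (ℚₚ.*-identityʳ (recPoly k))
        (trans (Σ<-cong k (λ m → ℚₚ.*-assoc y (c m) (choose i (3 ℕ.* suc m))))
          (trans (Σ<-*ˡ k y (λ m → c m * choose i (3 ℕ.* suc m))) (cong (y *_) (sym (recPolyAbove-closed k i)))))))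
    term : ∀ m → (c′ m + c′ m) * choose j (3 ℕ.+ p′ m) ≡ blockWeight m * recPoly (suc k ∸ suc m) * choose j (3 ℕ.* suc m)
    term zero    = cong (_* choose j 3) (solve 1 (λ a → a :+ a := con 1ℚ :* con two :* a) refl (recPoly k))
    term (suc m) = cong₂ _*_
      (solve 3 (λ y p a → y :* (p :* con two :* a) :+ y :* (p :* con two :* a) := con two :* y :* p :* con two :* a)
        refl y ((two * y) ^ℚ m) (recPoly (k ∸ suc m)))
      (cong (choose j) (sym (ℕₚ.*-suc 3 (suc m))))

  recPoly-suc : ∀ N →
    recPoly (suc N) ≡ Σ< (suc N) (λ m → blockWeight m * recPoly (N ∸ m) * choose (3 ℕ.* suc N) (3 ℕ.* suc m))
  recPoly-suc N = recPolyAbove-closed (suc N) (3 ℕ.* suc N)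

  forestPoly≡recPoly : ∀ n → forestPoly x n ≡ recPoly n
  forestPoly≡recPoly n = trans (sum-forests n weight) (sumForests-weight n (labelSet-LabelBag n))

  lhsCoeff≡recPoly : ∀ n → lhsCoeff x n ≡ recPoly n * inv! (3 ℕ.* n)
  lhsCoeff≡recPoly zero    = refl
  lhsCoeff≡recPoly (suc n) = cong (_* inv! (3 ℕ.* suc n)) (forestPoly≡recPoly (suc n))

  cauchyTerm : ∀ N m → m ℕ.≤ N →
    lhsCoeff x (N ∸ m) * denCoeff x (suc N ∸ (N ∸ m))
    ≡ y * inv! (3 ℕ.* suc N) * (blockWeight m * recPoly (N ∸ m) * choose (3 ℕ.* suc N) (3 ℕ.* suc m))
  cauchyTerm N m m≤N = begin
    lhsCoeff x (N ∸ m) * denCoeff x (suc N ∸ (N ∸ m))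
      ≡⟨ cong₂ _*_ (lhsCoeff≡recPoly (N ∸ m)) (cong (denCoeff x) suc[N∸[N∸m]]≡suc-m) ⟩
    a * I₂ * ((two * y) ^ℚ suc m * I₁)
      ≡⟨ cong (λ z → a * I₂ * (z * I₁)) (sym (y*blockWeight m)) ⟩
    a * I₂ * (y * blockWeight m * I₁)
      ≡⟨ solve 5 (λ a i₂ y b i₁ → a :* i₂ :* (y :* b :* i₁) := y :* (b :* a :* (i₁ :* i₂)))
           refl a I₂ y (blockWeight m) I₁ ⟩
    y * (blockWeight m * a * (I₁ * I₂))
      ≡⟨ cong (λ z → y * (blockWeight m * a * z)) (sym split-factorials) ⟩
    y * (blockWeight m * a * (C * I))
      ≡⟨ solve 4 (λ y e c i → y :* (e :* (c :* i)) := y :* i :* (e :* c)) refl y (blockWeight m * a) C I ⟩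
    y * I * (blockWeight m * a * C)
      ∎
    where
    open ≡-Reasoning
    a  = recPoly (N ∸ m)
    I  = inv! (3 ℕ.* suc N)
    I₁ = inv! (3 ℕ.* suc m)
    I₂ = inv! (3 ℕ.* (N ∸ m))
    C  = choose (3 ℕ.* suc N) (3 ℕ.* suc m)
    suc[N∸[N∸m]]≡suc-m : suc N ∸ (N ∸ m) ≡ suc m
    suc[N∸[N∸m]]≡suc-m = trans (ℕₚ.+-∸-assoc 1 (ℕₚ.m∸n≤m N m)) (cong suc (ℕₚ.m∸[m∸n]≡n m≤N))
    split-factorials : C * I ≡ I₁ * I₂
    split-factorials =
      subst (λ n → choose n (3 ℕ.* suc m) * inv! n ≡ I₁ * I₂)
            (trans (sym (ℕₚ.*-distribˡ-+ 3 (suc m) (N ∸ m))) (cong (λ n → 3 ℕ.* suc n) (ℕₚ.m+[n∸m]≡n m≤N)))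
            (choose-inv! (3 ℕ.* suc m) (3 ℕ.* (N ∸ m)))

  prodCoeff-zero : prodCoeff x 0 ≡ 1ℚ - x
  prodCoeff-zero = trans (ℚₚ.+-identityʳ _) (ℚₚ.*-identityˡ _)

  prodCoeff-suc : ∀ N → prodCoeff x (suc N) ≡ 0ℚ
  prodCoeff-suc N = begin
    prodCoeff x M
      ≡⟨ ΣL-applyUpTo (λ i → i) (suc M) g ⟩
    Σ< M g + g M
      ≡⟨ cong₂ _+_ (trans (Σ<-reverse N g) (Σ<-cong< M (λ m m<M → cauchyTerm N m (ℕₚ.≤-pred m<M))))
                   (cong (lhsCoeff x M *_) (cong (denCoeff x) (ℕₚ.n∸n≡0 M))) ⟩
    Σ< M (λ m → y * I * (blockWeight m * recPoly (N ∸ m) * choose (3 ℕ.* M) (3 ℕ.* suc m))) + lhsCoeff x M * (1ℚ - x)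
      ≡⟨ cong₂ _+_ (trans (Σ<-*ˡ M (y * I) _) (cong (y * I *_) (sym (recPoly-suc N))))
                   (cong (_* (1ℚ - x)) (lhsCoeff≡recPoly M)) ⟩
    y * I * recPoly M + recPoly M * I * (1ℚ - x)
      ≡⟨ solve 3 (λ x a i → (x :- con 1ℚ) :* i :* a :+ a :* i :* (con 1ℚ :- x) := con 0ℚ) refl x (recPoly M) I ⟩
    0ℚ
      ∎
    where
    open ≡-Reasoning
    M = suc N
    I = inv! (3 ℕ.* M)
    g : ℕ → ℚ
    g k = lhsCoeff x k * denCoeff x (M ∸ k)

mainTheorem5 : (x : ℚ) →
    (prodCoeff x 0 ≡ 1ℚ - x) × ((N : ℕ) → prodCoeff x (suc N) ≡ 0ℚ)
mainTheorem5 x = Count.prodCoeff-zero x , Count.prodCoeff-suc x
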